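{- Let $b\ge 2$ be an even integer, let $p\ge 1$ be an integer, and let $k=[1(0)^{\land p}]_b=b^p$. Let $N_k=[(1)^{\land k}]_b=\frac{b^k-1}{b-1}$. Then $N_k$ is a $b$-ARH number and is not a $b$-Niven number. Moreover, $N_k$ has a subset of additive multipliers of cardinality $2^{\frac{k-2p}{2}}$, consisting of all integers $[(1)^{\land p}I]_b$, where $I$ is a string of digits $0$ and $1$ of length $k-2p$ in which no two digits symmetric about the center of the string are identical.
   Context: Fix a base $b\ge 2$. For a string of digits $x$, $(x)^{\land m}$ denotes the string obtained by concatenating $x$ with itself $m$ times, and $[x]_b$ denotes the integer whose base-$b$ representation is the string $x$. For a positive integer $N$, $s_b(N)$ is the sum of the base-$b$ digits of $N$, and the reversal $N^R$ is the integer obtained by writing the base-$b$ digits of $N$ in reverse order. A positive integer $N$ is a $b$-ARH number if there exists a positive integer $M$ (called an additive multiplier of $N$) such that $N=Ms_b(N)+(Ms_b(N))^R$. A positive integer $N$ is a $b$-Niven number if $s_b(N)$ divides $N$. -}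

module Defs where

open import Data.Nat using (ℕ; zero; suc; _+_; _*_; _/_; _%_; _≤_)
open import Data.Nat.Divisibility using (_∣_)
open import Data.List using (List; []; _∷_; foldl; reverse; replicate; _++_)
open import Data.Nat.ListAction using (sum)
open import Data.Vec using (Vec; lookup)
open import Data.Fin using (Fin; opposite)
open import Data.Bool using (Bool; true; false)
open import Data.Product using (Σ; _×_)
open import Relation.Binary.PropositionalEquality using (_≡_; _≢_)

-- Little-endian base-b digits of n (least significant first); digits of 0 is [].
-- Fuel n suffices since every step strictly decreases n when b ≥ 2.
-- Only meaningful for b ≥ 2 (b = 0, 1 give [] by convention).
digitsAux : ℕ → ℕ → ℕ → List ℕ
digitsAux zero          _ _ = []
digitsAux (suc f)       b zero = []
digitsAux (suc f) (suc (suc c)) n@(suc _) = n % suc (suc c) ∷ digitsAux f (suc (suc c)) (n / suc (suc c))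
digitsAux (suc f)       _ (suc _) = []

digits : ℕ → ℕ → List ℕ
digits b n = digitsAux n b n

val : ℕ → List ℕ → ℕ
val b = foldl (λ acc d → acc * b + d) 0

s : ℕ → ℕ → ℕ
s b n = sum (digits b n)

-- N^R: reversal of base-b digits. digits is little-endian, so reading it
-- as a big-endian string gives the reversal.
rev : ℕ → ℕ → ℕ
rev b n = val b (digits b n)

AdditiveMultiplier : ℕ → ℕ → ℕ → Set
AdditiveMultiplier b N M = 1 ≤ M × N ≡ M * s b N + rev b (M * s b N)

ARH : ℕ → ℕ → Set
ARH b N = 1 ≤ N × Σ ℕ (AdditiveMultiplier b N)

Niven : ℕ → ℕ → Set
Niven b N = 1 ≤ N × s b N ∣ N

bit : Bool → ℕ
bit false = 0
bit true  = 1

Antisym : ∀ {n} → Vec Bool n → Set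
Antisym {n} I = (i : Fin n) → lookup I i ≢ lookup I (opposite i)

module Submission where

-- Call a digit string x
-- complementary if x_i + x_(ℓ-1-i) = 1 for all i.  For J complementary of
-- length k - 2p and M = [1^p J]_b we have s_b(N) = k = b^p, so M s_b(N) is
-- the framed string W = 1^p J 0^p, again complementary, and
-- M s_b(N) + (M s_b(N))^R = [W]_b + [reverse W]_b = [1^k]_b = N.
-- The theorem then only needs that b even makes k - 2p even.

open import Defs
open import Data.Nat using (ℕ; zero; suc; NonZero; _+_; _*_; _∸_; _^_; _/_; _%_; _≤_; _<_; z≤n; s≤s; s≤s⁻¹)
open import Data.Nat.Properties
open import Data.Nat.DivMod using (m/n<m; [m+kn]%n≡m%n; m<n⇒m%n≡m; +-distrib-/-∣ˡ; m*n/n≡m; m<n⇒m/n≡0; m/n*n≡m)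
open import Data.Nat.Divisibility using (_∣_; ∣-trans; m∣m*n; n∣m*n; n∣m⇒m%n≡0; ∣m+n∣m⇒∣n)
open import Data.Nat.ListAction using (sum)
open import Data.Nat.ListAction.Properties using (sum-↭)
open import Data.List using (List; []; _∷_; length; replicate; _++_; map; foldl; reverse; zipWith)
open import Data.List.Properties
  using (foldl-++; unfold-reverse; reverse-++; reverse-injective; length-reverse; length-++; length-map;
         length-replicate; ++-assoc; ++-identityʳ; ++-cancelˡ; map-++)
import Data.List.Properties as List
open import Data.List.Relation.Binary.Permutation.Propositional.Properties using (↭-reverse)
open import Data.List.Relation.Unary.All using (All; []; _∷_; universal)
import Data.List.Relation.Unary.All as All
open import Data.List.Relation.Unary.All.Properties using (++⁺; replicate⁺; map⁺)
open import Data.List.Relation.Unary.AllPairs using ([]; _∷_)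
open import Data.List.Relation.Unary.Unique.Propositional using (Unique)
import Data.List.Relation.Unary.Unique.Propositional.Properties as Unique
open import Data.List.Membership.Propositional using (_∈_)
open import Data.List.Membership.Propositional.Properties using (∈-map⁺; ∈-map⁻; ∈-++⁺ˡ; ∈-++⁺ʳ; ∈-++⁻)
open import Data.List.Relation.Unary.Any using (here)
open import Data.Vec using (Vec; []; _∷_; _∷ʳ_; lookup; toList; initLast)
open import Data.Vec.Properties using (∷ʳ-injectiveˡ; ∷-injectiveʳ; toList-∷ʳ; length-toList)
open import Data.Fin using (Fin; opposite; fromℕ; inject₁) renaming (zero to fzero; suc to fsuc)
open import Data.Fin.Properties using (opposite-involutive)
open import Data.Bool using (Bool; true; false; not)
open import Data.Bool.Properties using (not-¬; ¬-not)
open import Data.Product using (Σ; _×_; _,_)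
open import Data.Sum using (_⊎_; inj₁; inj₂)
open import Data.Empty using (⊥-elim)
open import Function.Bundles using (_⇔_; mk⇔)
open import Relation.Nullary using (¬_)
open import Relation.Binary.PropositionalEquality using (_≡_; _≢_; refl; sym; trans; cong; cong₂; subst; module ≡-Reasoning)
open import Data.Nat.Solver using (module +-*-Solver)
open +-*-Solver using (solve; _:+_; _:*_; _:=_; con)

open ≡-Reasoning

replicate-+ : ∀ {A : Set} m n (x : A) → replicate (m + n) x ≡ replicate m x ++ replicate n x
replicate-+ zero    n x = refl
replicate-+ (suc m) n x = cong (x ∷_) (replicate-+ m n x)

replicate-snoc : ∀ {A : Set} n (x : A) → replicate n x ++ x ∷ [] ≡ x ∷ replicate n x
replicate-snoc zero    x = refl
replicate-snoc (suc n) x = cong (x ∷_) (replicate-snoc n x)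

sum-ones : ∀ n → sum (replicate n 1) ≡ n
sum-ones zero    = refl
sum-ones (suc n) = cong suc (sum-ones n)

zipWith-++ : ∀ {A B C : Set} (f : A → B → C) (xs : List A) (ys : List B) xs' ys' →
  length xs ≡ length ys → zipWith f (xs ++ xs') (ys ++ ys') ≡ zipWith f xs ys ++ zipWith f xs' ys'
zipWith-++ f []       []       xs' ys' _  = refl
zipWith-++ f (x ∷ xs) (y ∷ ys) xs' ys' eq = cong (f x y ∷_) (zipWith-++ f xs ys xs' ys' (suc-injective eq))

Complementary : List ℕ → Set
Complementary xs = zipWith _+_ xs (reverse xs) ≡ replicate (length xs) 1

complementary-wrap : ∀ a c K → a + c ≡ 1 → Complementary K → Complementary (a ∷ K ++ c ∷ [])
complementary-wrap a c K a+c≡1 compK = begin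
  zipWith _+_ (a ∷ K ++ c ∷ []) (reverse (a ∷ K ++ c ∷ []))
    ≡⟨ cong (zipWith _+_ (a ∷ K ++ c ∷ [])) reversed ⟩
  a + c ∷ zipWith _+_ (K ++ c ∷ []) (reverse K ++ a ∷ [])
    ≡⟨ cong (a + c ∷_) (zipWith-++ _+_ K (reverse K) (c ∷ []) (a ∷ []) (sym (length-reverse K))) ⟩
  a + c ∷ zipWith _+_ K (reverse K) ++ c + a ∷ []
    ≡⟨ cong₂ (λ u v → u ∷ v ++ c + a ∷ []) a+c≡1 compK ⟩
  1 ∷ replicate (length K) 1 ++ c + a ∷ []
    ≡⟨ cong (λ u → 1 ∷ replicate (length K) 1 ++ u ∷ []) (trans (+-comm c a) a+c≡1) ⟩
  1 ∷ replicate (length K) 1 ++ 1 ∷ []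
    ≡⟨ cong (1 ∷_) (sym (replicate-+ (length K) 1 1)) ⟩
  1 ∷ replicate (length K + 1) 1
    ≡⟨ cong (λ l → 1 ∷ replicate l 1) (sym (length-++ K)) ⟩
  replicate (length (a ∷ K ++ c ∷ [])) 1 ∎
  where
  reversed : reverse (a ∷ K ++ c ∷ []) ≡ c ∷ reverse K ++ a ∷ []
  reversed = trans (unfold-reverse a (K ++ c ∷ [])) (cong (_++ a ∷ []) (reverse-++ K (c ∷ [])))

frame : ℕ → List ℕ → List ℕ
frame p K = replicate p 1 ++ K ++ replicate p 0

length-frame : ∀ p K → length (frame p K) ≡ p + (length K + p)
length-frame p K = begin
  length (replicate p 1 ++ K ++ replicate p 0)           ≡⟨ length-++ (replicate p 1) ⟩
  length (replicate p 1) + length (K ++ replicate p 0)   ≡⟨ cong₂ _+_ (length-replicate p) (length-++ K) ⟩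
  p + (length K + length (replicate p 0))               ≡⟨ cong (λ l → p + (length K + l)) (length-replicate p) ⟩
  p + (length K + p)                                   ∎

-- Framing preserves complementarity: it wraps K in p pairs (1, 0).
complementary-frame : ∀ p K → Complementary K → Complementary (frame p K)
complementary-frame zero    K compK = subst Complementary (sym (++-identityʳ K)) compK
complementary-frame (suc p) K compK =
  subst Complementary reassociate (complementary-wrap 1 0 (frame p K) refl (complementary-frame p K compK))
  where
  ones : List ℕ
  ones = replicate p 1
  reassociate : 1 ∷ frame p K ++ 0 ∷ [] ≡ frame (suc p) K
  reassociate = cong (1 ∷_) (begin
    (ones ++ K ++ replicate p 0) ++ 0 ∷ [] ≡⟨ ++-assoc ones (K ++ replicate p 0) (0 ∷ []) ⟩
    ones ++ (K ++ replicate p 0) ++ 0 ∷ [] ≡⟨ cong (ones ++_) (++-assoc K (replicate p 0) (0 ∷ [])) ⟩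
    ones ++ K ++ replicate p 0 ++ 0 ∷ []   ≡⟨ cong (λ z → ones ++ K ++ z) (replicate-snoc p 0) ⟩
    ones ++ K ++ 0 ∷ replicate p 0         ∎)

valFrom : ℕ → ℕ → List ℕ → ℕ
valFrom b = foldl (λ acc d → acc * b + d)

valFrom-shift : ∀ b a ys → valFrom b a ys ≡ a * b ^ length ys + val b ys
valFrom-shift b a []       = sym (trans (+-identityʳ (a * 1)) (*-identityʳ a))
valFrom-shift b a (y ∷ ys) = begin
  valFrom b (a * b + y) ys                  ≡⟨ valFrom-shift b (a * b + y) ys ⟩
  (a * b + y) * b ^ length ys + val b ys    ≡⟨ solve 5 (λ a y b P F → (a :* b :+ y) :* P :+ F := a :* (b :* P) :+ (y :* P :+ F))
                                                 refl a y b (b ^ length ys) (val b ys) ⟩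
  a * (b * b ^ length ys) + (y * b ^ length ys + val b ys) ≡⟨ cong (a * (b * b ^ length ys) +_) (sym (valFrom-shift b y ys)) ⟩
  a * b ^ length (y ∷ ys) + val b (y ∷ ys)  ∎

val-++ : ∀ b xs ys → val b (xs ++ ys) ≡ val b xs * b ^ length ys + val b ys
val-++ b xs ys = trans (foldl-++ _ 0 xs ys) (valFrom-shift b (val b xs) ys)

val-++-zeros : ∀ b xs p → val b (xs ++ replicate p 0) ≡ val b xs * b ^ p
val-++-zeros b xs p = begin
  val b (xs ++ replicate p 0)                                ≡⟨ val-++ b xs (replicate p 0) ⟩
  val b xs * b ^ length (replicate p 0) + val b (replicate p 0) ≡⟨ cong₂ (λ l z → val b xs * b ^ l + z) (length-replicate p) (zeros p) ⟩
  val b xs * b ^ p + 0                                       ≡⟨ +-identityʳ _ ⟩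
  val b xs * b ^ p                                           ∎
  where
  zeros : ∀ p → val b (replicate p 0) ≡ 0
  zeros zero    = refl
  zeros (suc p) = zeros p

valFrom-zipWith : ∀ b a a' xs ys → length xs ≡ length ys →
  valFrom b a xs + valFrom b a' ys ≡ valFrom b (a + a') (zipWith _+_ xs ys)
valFrom-zipWith b a a' []       []       _  = refl
valFrom-zipWith b a a' (x ∷ xs) (y ∷ ys) eq =
  trans (valFrom-zipWith b (a * b + x) (a' * b + y) xs ys (suc-injective eq))
        (cong (λ z → valFrom b z (zipWith _+_ xs ys))
              (solve 5 (λ a a' x y b → (a :* b :+ x) :+ (a' :* b :+ y) := (a :+ a') :* b :+ (x :+ y)) refl a a' x y b))

val-zipWith : ∀ b xs ys → length xs ≡ length ys → val b xs + val b ys ≡ val b (zipWith _+_ xs ys)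
val-zipWith b = valFrom-zipWith b 0 0

valFrom-≥ : ∀ b .{{_ : NonZero b}} a xs → a ≤ valFrom b a xs
valFrom-≥ b a []       = ≤-refl
valFrom-≥ b a (x ∷ xs) = ≤-trans (≤-trans (m≤m*n a b) (m≤m+n (a * b) x)) (valFrom-≥ b (a * b + x) xs)

repunit : ℕ → ℕ → ℕ
repunit b k = val b (replicate k 1)

repunit-positive : ∀ b .{{_ : NonZero b}} K → 1 ≤ repunit b (suc K)
repunit-positive b K = valFrom-≥ b 1 (replicate K 1)

bits : ∀ {n} → Vec Bool n → List ℕ
bits I = map bit (toList I)

bits-injective : ∀ {n} (I J : Vec Bool n) → bits I ≡ bits J → I ≡ J
bits-injective []      []      _  = refl
bits-injective (x ∷ I) (y ∷ J) eq =
  cong₂ _∷_ (bit-injective x y (List.∷-injectiveˡ eq)) (bits-injective I J (List.∷-injectiveʳ eq))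
  where
  bit-injective : ∀ x y → bit x ≡ bit y → x ≡ y
  bit-injective false false _ = refl
  bit-injective true  true  _ = refl

length-bits : ∀ {n} (I : Vec Bool n) → length (bits I) ≡ n
length-bits I = trans (length-map bit (toList I)) (length-toList I)

lookup-last : ∀ {A : Set} {k} (v : Vec A k) y → lookup (v ∷ʳ y) (fromℕ k) ≡ y
lookup-last []      y = refl
lookup-last (a ∷ v) y = lookup-last v y

lookup-inject₁ : ∀ {A : Set} {k} (v : Vec A k) y (i : Fin k) → lookup (v ∷ʳ y) (inject₁ i) ≡ lookup v i
lookup-inject₁ (a ∷ v) y fzero    = refl
lookup-inject₁ (a ∷ v) y (fsuc i) = lookup-inject₁ v y i

opposite-inject₁ : ∀ {k} (i : Fin k) → opposite {suc k} (inject₁ i) ≡ fsuc (opposite i)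
opposite-inject₁ {suc k} fzero    = refl
opposite-inject₁ {suc k} (fsuc i) = cong inject₁ (opposite-inject₁ i)

fin-split : ∀ {k} (j : Fin (suc k)) → j ≡ fromℕ k ⊎ Σ (Fin k) (λ i → j ≡ inject₁ i)
fin-split {zero}  fzero    = inj₁ refl
fin-split {suc k} fzero    = inj₂ (fzero , refl)
fin-split {suc k} (fsuc j) with fin-split j
... | inj₁ j≡last     = inj₁ (cong fsuc j≡last)
... | inj₂ (i , j≡i) = inj₂ (fsuc i , cong fsuc j≡i)

-- x ∷ (v ∷ʳ y) is antisymmetric iff x ≢ y and v is antisymmetric: the outer
-- positions mirror each other and the inner ones mirror positions of v.
module Enclose {k} (x y : Bool) (v : Vec Bool k) where

  private
    inner : ∀ i → lookup (x ∷ (v ∷ʳ y)) (fsuc (inject₁ i)) ≡ lookup v i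
    inner i = lookup-inject₁ v y i

    inner-mirror : ∀ i → lookup (x ∷ (v ∷ʳ y)) (opposite (fsuc (inject₁ i))) ≡ lookup v (opposite i)
    inner-mirror i = trans (cong (λ j → lookup (x ∷ (v ∷ʳ y)) (inject₁ j)) (opposite-inject₁ i)) (lookup-inject₁ v y (opposite i))

    outer-mirror : lookup (x ∷ (v ∷ʳ y)) (opposite fzero) ≡ y
    outer-mirror = lookup-last v y

  antisym-enclose : x ≢ y → Antisym v → Antisym (x ∷ (v ∷ʳ y))
  antisym-enclose x≢y antiV fzero eq = x≢y (trans eq outer-mirror)
  antisym-enclose x≢y antiV (fsuc j) eq with fin-split j
  ... | inj₁ refl    = x≢y (sym (trans (sym outer-mirror) (trans eq (cong (lookup (x ∷ (v ∷ʳ y))) last-mirror))))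
    where
    last-mirror : opposite (fsuc (fromℕ k)) ≡ fzero
    last-mirror = opposite-involutive {suc (suc k)} fzero
  ... | inj₂ (i , refl) = antiV i (trans (sym (inner i)) (trans eq (inner-mirror i)))

  antisym-unenclose : Antisym (x ∷ (v ∷ʳ y)) → x ≢ y × Antisym v
  antisym-unenclose anti = (λ x≡y → anti fzero (trans x≡y (sym outer-mirror)))
                         , (λ i eq → anti (fsuc (inject₁ i)) (trans (inner i) (trans eq (sym (inner-mirror i)))))

open Enclose using (antisym-enclose; antisym-unenclose)

wrap : ∀ {n} → Bool → Vec Bool n → Vec Bool (suc (suc n))
wrap x v = x ∷ (v ∷ʳ not x)

antisym-view : ∀ {n} (w : Vec Bool (suc (suc n))) → Antisym w →
  Σ Bool (λ x → Σ (Vec Bool n) (λ v → w ≡ wrap x v × Antisym v))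
antisym-view (x ∷ w) anti with initLast w
... | v , y , refl with antisym-unenclose x y v anti
... | x≢y , antiV = x , v , cong (λ z → x ∷ (v ∷ʳ z)) (¬-not (λ y≡x → x≢y (sym y≡x))) , antiV

antisymmetric : ∀ n → List (Vec Bool n)
antisymmetric zero          = [] ∷ []
antisymmetric (suc zero)    = []
antisymmetric (suc (suc n)) = map (wrap true) (antisymmetric n) ++ map (wrap false) (antisymmetric n)

∈-wraps⁻ : ∀ {n} (L : List (Vec Bool n)) {w} → w ∈ map (wrap true) L ++ map (wrap false) L →
  Σ Bool (λ x → Σ (Vec Bool n) (λ v → v ∈ L × w ≡ wrap x v))
∈-wraps⁻ L mem with ∈-++⁻ (map (wrap true) L) mem
... | inj₁ inTrue  = let v , v∈L , eq = ∈-map⁻ (wrap true) inTrue  in true  , v , v∈L , eq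
... | inj₂ inFalse = let v , v∈L , eq = ∈-map⁻ (wrap false) inFalse in false , v , v∈L , eq

∈-wraps⁺ : ∀ {n} {L : List (Vec Bool n)} x {v} → v ∈ L → wrap x v ∈ map (wrap true) L ++ map (wrap false) L
∈-wraps⁺         true  v∈L = ∈-++⁺ˡ (∈-map⁺ (wrap true) v∈L)
∈-wraps⁺ {L = L} false v∈L = ∈-++⁺ʳ (map (wrap true) L) (∈-map⁺ (wrap false) v∈L)

-- The list contains exactly the antisymmetric vectors, each once.  Odd lengths
-- contribute nothing, since the middle position would be its own mirror image.
antisymmetric-sound : ∀ n (I : Vec Bool n) → I ∈ antisymmetric n → Antisym I
antisymmetric-sound zero          []  _   = λ ()
antisymmetric-sound (suc (suc n)) I mem with ∈-wraps⁻ (antisymmetric n) mem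
... | x , v , v∈L , refl = antisym-enclose x (not x) v (not-¬ refl) (antisymmetric-sound n v v∈L)

antisymmetric-complete : ∀ n (I : Vec Bool n) → Antisym I → I ∈ antisymmetric n
antisymmetric-complete zero          []      _    = here refl
antisymmetric-complete (suc zero)    (x ∷ []) anti = ⊥-elim (anti fzero refl)
antisymmetric-complete (suc (suc n)) I       anti with antisym-view I anti
... | x , v , refl , antiV = ∈-wraps⁺ x (antisymmetric-complete n v antiV)

antisymmetric-unique : ∀ n → Unique (antisymmetric n)
antisymmetric-unique zero          = [] ∷ []
antisymmetric-unique (suc zero)    = []
antisymmetric-unique (suc (suc n)) =
  Unique.++⁺ (Unique.map⁺ wrap-injective (antisymmetric-unique n))
             (Unique.map⁺ wrap-injective (antisymmetric-unique n)) disjoint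
  where
  wrap-injective : ∀ {x} {v w : Vec Bool n} → wrap x v ≡ wrap x w → v ≡ w
  wrap-injective {v = v} {w} eq = ∷ʳ-injectiveˡ v w (∷-injectiveʳ eq)
  disjoint : ∀ {u} → ¬ (u ∈ map (wrap true) (antisymmetric n) × u ∈ map (wrap false) (antisymmetric n))
  disjoint (inTrue , inFalse) with ∈-map⁻ (wrap true) inTrue | ∈-map⁻ (wrap false) inFalse
  ... | _ , _ , refl | _ , _ , ()

length-antisymmetric : ∀ m → length (antisymmetric (m * 2)) ≡ 2 ^ m
length-antisymmetric zero    = refl
length-antisymmetric (suc m) = begin
  length (map (wrap true) L ++ map (wrap false) L)          ≡⟨ length-++ (map (wrap true) L) ⟩
  length (map (wrap true) L) + length (map (wrap false) L)  ≡⟨ cong₂ _+_ (length-map (wrap true) L) (length-map (wrap false) L) ⟩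
  length L + length L                                       ≡⟨ cong₂ _+_ (length-antisymmetric m) (trans (length-antisymmetric m) (sym (+-identityʳ (2 ^ m)))) ⟩
  2 ^ m + (2 ^ m + 0)                                       ∎
  where
  L : List (Vec Bool (m * 2))
  L = antisymmetric (m * 2)

antisym-complementary : ∀ n (I : Vec Bool n) → Antisym I → Complementary (bits I)
antisym-complementary zero          []       _    = refl
antisym-complementary (suc zero)    (x ∷ []) anti = ⊥-elim (anti fzero refl)
antisym-complementary (suc (suc n)) I        anti with antisym-view I anti
... | x , v , refl , antiV =
  subst Complementary (sym bits-wrap) (complementary-wrap (bit x) (bit (not x)) (bits v) (bit-not x) (antisym-complementary n v antiV))
  where
  bit-not : ∀ x → bit x + bit (not x) ≡ 1
  bit-not false = refl
  bit-not true  = refl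
  bits-wrap : bits (wrap x v) ≡ bit x ∷ bits v ++ bit (not x) ∷ []
  bits-wrap = cong (bit x ∷_) (trans (cong (map bit) (toList-∷ʳ (not x) v)) (map-++ bit (toList v) (not x ∷ [])))

module Base (c : ℕ) where

  B : ℕ
  B = suc (suc c)

  1<B : 1 < B
  1<B = s≤s (s≤s z≤n)

  0<B : 0 < B
  0<B = s≤s z≤n

  last-digit : ∀ v d → d < B → (v * B + d) % B ≡ d
  last-digit v d d<B = trans (cong (_% B) (+-comm (v * B) d)) (trans ([m+kn]%n≡m%n d v B) (m<n⇒m%n≡m d<B))

  drop-last-digit : ∀ v d → d < B → (v * B + d) / B ≡ v
  drop-last-digit v d d<B = begin
    (v * B + d) / B   ≡⟨ +-distrib-/-∣ˡ d (n∣m*n v) ⟩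
    v * B / B + d / B ≡⟨ cong₂ _+_ (m*n/n≡m v B) (m<n⇒m/n≡0 d<B) ⟩
    v + 0             ≡⟨ +-identityʳ v ⟩
    v                 ∎

  digitsAux-zero : ∀ f → digitsAux f B 0 ≡ []
  digitsAux-zero zero    = refl
  digitsAux-zero (suc f) = refl

  digitsAux-fuel : ∀ f g n → n ≤ f → n ≤ g → digitsAux f B n ≡ digitsAux g B n
  digitsAux-fuel f g zero _ _ = trans (digitsAux-zero f) (sym (digitsAux-zero g))
  digitsAux-fuel (suc f) (suc g) n@(suc m) (s≤s m≤f) (s≤s m≤g) =
    cong (n % B ∷_) (digitsAux-fuel f g (n / B) (quotient≤ m≤f) (quotient≤ m≤g))
    where
    quotient≤ : ∀ {h} → m ≤ h → n / B ≤ h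
    quotient≤ le = ≤-trans (s≤s⁻¹ (m/n<m n B 1<B)) le

  digits-positive : ∀ n → 0 < n → digits B n ≡ n % B ∷ digits B (n / B)
  digits-positive n@(suc m) _ =
    cong (n % B ∷_) (digitsAux-fuel m (n / B) (n / B) (s≤s⁻¹ (m/n<m n B 1<B)) ≤-refl)

  digits-push : ∀ v d → d < B → 0 < v * B + d → digits B (v * B + d) ≡ d ∷ digits B v
  digits-push v d d<B pos =
    trans (digits-positive (v * B + d) pos) (cong₂ _∷_ (last-digit v d d<B) (cong (digits B) (drop-last-digit v d d<B)))

  digits-valFrom : ∀ a xs → 0 < a → All (_< B) xs → digits B (valFrom B a xs) ≡ reverse xs ++ digits B a
  digits-valFrom a []       _   []            = refl
  digits-valFrom a (x ∷ xs) pos (x<B ∷ xs<B) = begin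
    digits B (valFrom B (a * B + x) xs)        ≡⟨ digits-valFrom (a * B + x) xs pos' xs<B ⟩
    reverse xs ++ digits B (a * B + x)        ≡⟨ cong (reverse xs ++_) (digits-push a x x<B pos') ⟩
    reverse xs ++ x ∷ digits B a              ≡⟨ sym (++-assoc (reverse xs) (x ∷ []) (digits B a)) ⟩
    (reverse xs ++ x ∷ []) ++ digits B a      ≡⟨ cong (_++ digits B a) (sym (unfold-reverse x xs)) ⟩
    reverse (x ∷ xs) ++ digits B a            ∎
    where
    pos' : 0 < a * B + x
    pos' = ≤-trans pos (≤-trans (m≤m*n a B) (m≤m+n (a * B) x))

  digits-val : ∀ e xs → 0 < e → e < B → All (_< B) xs → digits B (val B (e ∷ xs)) ≡ reverse (e ∷ xs)
  digits-val e xs 0<e e<B xs<B = begin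
    digits B (valFrom B e xs)    ≡⟨ digits-valFrom e xs 0<e xs<B ⟩
    reverse xs ++ digits B e     ≡⟨ cong (reverse xs ++_) (digits-push 0 e e<B 0<e) ⟩
    reverse xs ++ e ∷ []         ≡⟨ sym (unfold-reverse e xs) ⟩
    reverse (e ∷ xs)             ∎

  rev-val : ∀ e xs → 0 < e → e < B → All (_< B) xs → rev B (val B (e ∷ xs)) ≡ val B (reverse (e ∷ xs))
  rev-val e xs 0<e e<B xs<B = cong (val B) (digits-val e xs 0<e e<B xs<B)

  digitSum-val : ∀ e xs → 0 < e → e < B → All (_< B) xs → s B (val B (e ∷ xs)) ≡ sum (e ∷ xs)
  digitSum-val e xs 0<e e<B xs<B = trans (cong sum (digits-val e xs 0<e e<B xs<B)) (sum-↭ (↭-reverse (e ∷ xs)))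

  val-injective : ∀ xs ys → All (_< B) xs → All (_< B) ys →
    val B (1 ∷ xs) ≡ val B (1 ∷ ys) → xs ≡ ys
  val-injective xs ys xs<B ys<B eq = List.∷-injectiveʳ (reverse-injective (begin
    reverse (1 ∷ xs)            ≡⟨ sym (digits-val 1 xs (s≤s z≤n) 1<B xs<B) ⟩
    digits B (val B (1 ∷ xs))   ≡⟨ cong (digits B) eq ⟩
    digits B (val B (1 ∷ ys))   ≡⟨ digits-val 1 ys (s≤s z≤n) 1<B ys<B ⟩
    reverse (1 ∷ ys)            ∎))

  repunit-digitSum : ∀ K → s B (repunit B (suc K)) ≡ suc K
  repunit-digitSum K = trans (digitSum-val 1 (replicate K 1) (s≤s z≤n) 1<B (replicate⁺ K 1<B)) (sum-ones (suc K))

  -- A repunit whose length is divisible by B is not B-Niven: B divides its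
  -- digit sum, but the repunit ends in the digit 1.
  repunit-not-Niven : ∀ k → B ∣ k → ¬ Niven B (repunit B k)
  repunit-not-Niven zero    _   (() , _)
  repunit-not-Niven (suc K) B∣k (_ , digitSum∣N) = 1+n≢0 (begin
    1                         ≡⟨ sym (last-digit (repunit B K) 1 1<B) ⟩
    (repunit B K * B + 1) % B ≡⟨ cong (_% B) (sym ends-in-1) ⟩
    repunit B (suc K) % B     ≡⟨ n∣m⇒m%n≡0 _ B (∣-trans B∣k k∣N) ⟩
    0                         ∎)
    where
    ends-in-1 : repunit B (suc K) ≡ repunit B K * B + 1
    ends-in-1 = trans (cong (val B) (sym (replicate-snoc K 1))) (foldl-++ _ 0 (replicate K 1) (1 ∷ []))
    k∣N : suc K ∣ repunit B (suc K)
    k∣N = subst (_∣ repunit B (suc K)) (repunit-digitSum K) digitSum∣N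

  complementary-value : ∀ xs → All (_< B) xs → Complementary (1 ∷ xs) →
    val B (1 ∷ xs) + rev B (val B (1 ∷ xs)) ≡ repunit B (length (1 ∷ xs))
  complementary-value xs xs<B comp = begin
    val B W + rev B (val B W)         ≡⟨ cong (val B W +_) (rev-val 1 xs (s≤s z≤n) 1<B xs<B) ⟩
    val B W + val B (reverse W)       ≡⟨ val-zipWith B W (reverse W) (sym (length-reverse W)) ⟩
    val B (zipWith _+_ W (reverse W)) ≡⟨ cong (val B) comp ⟩
    repunit B (length W)              ∎
    where
    W : List ℕ
    W = 1 ∷ xs

  -- If J is a complementary string of digits below B with 2p + |J| = B ^ p,
  -- then [1^p J]_B is an additive multiplier of the repunit of length B ^ p:
  -- multiplying by the digit sum B ^ p appends p zeros, giving the framed string.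
  framed-multiplier : ∀ p' J → All (_< B) J → Complementary J →
    B ^ suc p' ≡ length (frame (suc p') J) →
    AdditiveMultiplier B (repunit B (B ^ suc p')) (val B (replicate (suc p') 1 ++ J))
  framed-multiplier p' J J<B compJ hk = valFrom-≥ B 1 (replicate p' 1 ++ J) , (begin
    N                              ≡⟨ cong (repunit B) hk ⟩
    repunit B (length W)           ≡⟨ sym (complementary-value rest rest<B (complementary-frame p J compJ)) ⟩
    val B W + rev B (val B W)      ≡⟨ cong (λ z → z + rev B z) (sym shifted) ⟩
    M * B ^ p + rev B (M * B ^ p)  ≡⟨ cong (λ z → M * z + rev B (M * z)) (sym digitSum) ⟩
    M * s B N + rev B (M * s B N)  ∎)
    where
    p N M : ℕ
    p = suc p'
    N = repunit B (B ^ p)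
    M = val B (replicate p 1 ++ J)
    W rest : List ℕ
    W = frame p J
    rest = replicate p' 1 ++ J ++ replicate p 0
    rest<B : All (_< B) rest
    rest<B = ++⁺ (replicate⁺ p' 1<B) (++⁺ J<B (replicate⁺ p 0<B))
    digitSum : s B N ≡ B ^ p
    digitSum = subst (λ k → s B (repunit B k) ≡ k) (sym hk) (repunit-digitSum (length rest))
    shifted : M * B ^ p ≡ val B W
    shifted = trans (sym (val-++-zeros B (replicate p 1 ++ J) p)) (cong (val B) (++-assoc (replicate p 1) J (replicate p 0)))

  bits<B : ∀ {n} (I : Vec Bool n) → All (_< B) (bits I)
  bits<B I = map⁺ (universal bit<B (toList I))
    where
    bit<B : ∀ x → bit x < B
    bit<B false = 0<B
    bit<B true  = 1<B

  multiplier : ∀ {n} → ℕ → Vec Bool n → ℕ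
  multiplier p I = val B (replicate p 1 ++ bits I)

  multiplier-injective : ∀ p' {n} {I J : Vec Bool n} → multiplier (suc p') I ≡ multiplier (suc p') J → I ≡ J
  multiplier-injective p' {I = I} {J} eq = bits-injective I J (++-cancelˡ (replicate p' 1) (bits I) (bits J)
    (val-injective _ _ (++⁺ (replicate⁺ p' 1<B) (bits<B I)) (++⁺ (replicate⁺ p' 1<B) (bits<B J)) eq))

  multipliers : ℕ → ℕ → List ℕ
  multipliers p n = map (multiplier p) (antisymmetric n)

  multipliers-unique : ∀ p' n → Unique (multipliers (suc p') n)
  multipliers-unique p' n = Unique.map⁺ (multiplier-injective p') (antisymmetric-unique n)

  ∈-multipliers : ∀ p n M → (M ∈ multipliers p n) ⇔ Σ (Vec Bool n) (λ I → Antisym I × M ≡ multiplier p I)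
  ∈-multipliers p n M = mk⇔ to from
    where
    to : M ∈ multipliers p n → Σ (Vec Bool n) (λ I → Antisym I × M ≡ multiplier p I)
    to mem = let I , I∈ , eq = ∈-map⁻ (multiplier p) mem in I , antisymmetric-sound n I I∈ , eq
    from : Σ (Vec Bool n) (λ I → Antisym I × M ≡ multiplier p I) → M ∈ multipliers p n
    from (I , anti , refl) = ∈-map⁺ (multiplier p) (antisymmetric-complete n I anti)

  length-multipliers : ∀ p m → length (multipliers p (m * 2)) ≡ 2 ^ m
  length-multipliers p m = trans (length-map (multiplier p) (antisymmetric (m * 2))) (length-antisymmetric m)

  multipliers-additive : ∀ p' n → B ^ suc p' ≡ suc p' + (n + suc p') →
    All (AdditiveMultiplier B (repunit B (B ^ suc p'))) (multipliers (suc p') n)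
  multipliers-additive p' n shape = map⁺ (All.tabulate additive)
    where
    additive : ∀ {I} → I ∈ antisymmetric n → AdditiveMultiplier B (repunit B (B ^ suc p')) (multiplier (suc p') I)
    additive {I} I∈ = framed-multiplier p' (bits I) (bits<B I) (antisym-complementary n I (antisymmetric-sound n I I∈))
      (trans shape (sym framed-length))
      where
      framed-length : length (frame (suc p') (bits I)) ≡ suc p' + (n + suc p')
      framed-length = trans (length-frame (suc p') (bits I)) (cong (λ l → suc p' + (l + suc p')) (length-bits I))

witness : ∀ {A : Set} {P : A → Set} (L : List A) → All P L → 0 < length L → Σ A P
witness (x ∷ _) (px ∷ _) _ = x , px

p<2^p : ∀ p → p < 2 ^ p
p<2^p zero    = s≤s z≤n
p<2^p (suc p) = +-mono-≤ (m^n>0 2 p) (≤-trans (p<2^p p) (m≤m+n (2 ^ p) 0))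

2p≤b^p : ∀ b p → 2 ≤ b → 2 * p ≤ b ^ p
2p≤b^p b zero    _   = z≤n
2p≤b^p b (suc p) 2≤b = ≤-trans (*-monoʳ-≤ 2 (p<2^p p)) (^-monoˡ-≤ (suc p) 2≤b)

even-middle : ∀ b p' → 2 ≤ b → 2 ∣ b → 2 ∣ b ^ suc p' ∸ 2 * suc p'
even-middle b p' 2≤b 2∣b =
  ∣m+n∣m⇒∣n (subst (2 ∣_) (sym (m+[n∸m]≡n (2p≤b^p b (suc p') 2≤b))) (∣-trans 2∣b (m∣m*n (b ^ p')))) (m∣m*n (suc p'))

-- With b = B, n = B ^ p - 2p = 2m: the multipliers of the antisymmetric
-- vectors of length n form the required list; any one of them witnesses that N
-- is ARH, and N is not Niven because B divides its length B ^ p.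
theorem12 : (b p : ℕ) → 2 ≤ b → 2 ∣ b → 1 ≤ p →
    ARH b (val b (replicate (b ^ p) 1))
    × ¬ Niven b (val b (replicate (b ^ p) 1))
    × Σ (List ℕ) (λ L →
        Unique L
        × length L ≡ 2 ^ ((b ^ p ∸ 2 * p) / 2)
        × ((M : ℕ) → (M ∈ L) ⇔ Σ (Vec Bool (b ^ p ∸ 2 * p)) (λ I →
              Antisym I × M ≡ val b (replicate p 1 ++ map bit (toList I))))
        × All (AdditiveMultiplier b (val b (replicate (b ^ p) 1))) L)
theorem12 (suc zero) _ (s≤s ()) _ _
theorem12 (suc (suc c)) (suc p') 2≤b 2∣b _ =
    (N-positive , witness L additive (subst (0 <_) (sym size) (m^n>0 2 m)))
  , repunit-not-Niven (B ^ p) (m∣m*n (B ^ p'))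
  , L , multipliers-unique p' n , size , ∈-multipliers p n , additive
  where
  open Base c
  p n m : ℕ
  p = suc p'
  n = B ^ p ∸ 2 * p
  m = n / 2
  shape : B ^ p ≡ p + (n + p)
  shape = sym (trans (solve 2 (λ p n → p :+ (n :+ p) := n :+ con 2 :* p) refl p n) (m∸n+n≡m (2p≤b^p B p 2≤b)))
  L : List ℕ
  L = multipliers p n
  size : length L ≡ 2 ^ m
  size = subst (λ k → length (multipliers p k) ≡ 2 ^ m) (m/n*n≡m (even-middle B p' 2≤b 2∣b)) (length-multipliers p m)
  additive : All (AdditiveMultiplier B (repunit B (B ^ p))) L
  additive = multipliers-additive p' n shape
  N-positive : 1 ≤ repunit B (B ^ p)
  N-positive = subst (λ k → 1 ≤ repunit B k) (sym shape) (repunit-positive B (p' + (n + p)))
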